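{- Let $\mathit{prop},\mathit{prop}_1,\mathit{prop}_2$ be properties of binary relations, and write "$R$ is $p$-$\mathit{prop}$" for "$R^p$ has $\mathit{prop}$". (1) If for all relations $R$, $\mathit{prop}_1(R^{p_1})$ implies $\mathit{prop}_2(R^{p_2})$, then for every operation $r$ and all $R$, $\mathit{prop}_1(R^{p_1\circ r})$ implies $\mathit{prop}_2(R^{p_2\circ r})$. (2) If ($R$ is 3-$\mathit{prop}$ iff 5-$\mathit{prop}$) for all $R$, then for all $R$: 2-$\mathit{prop}\leftrightarrow$4-$\mathit{prop}$, A-$\mathit{prop}\leftrightarrow$C-$\mathit{prop}$, B-$\mathit{prop}\leftrightarrow$D-$\mathit{prop}$. The hypothesis holds for $\mathit{prop}\in\{$reflexive, quasi-reflexive, symmetric, asymmetric, anti-symmetric, transitive, anti-transitive, semi-order property 1, semi-order property 2, dense$\}$. (3) If (1-$\mathit{prop}\leftrightarrow$3-$\mathit{prop}$) for all $R$, then for all $R$: 0-$\mathit{prop}\leftrightarrow$4-$\mathit{prop}$, 1-$\mathit{prop}\leftrightarrow$5-$\mathit{prop}$, 8-$\mathit{prop}\leftrightarrow$A-$\mathit{prop}$, 9-$\mathit{prop}\leftrightarrow$B-$\mathit{prop}$, 8-$\mathit{prop}\leftrightarrow$C-$\mathit{prop}$. The hypothesis holds for $\mathit{prop}\in\{$reflexive, asymmetric, anti-symmetric$\}$. (4) If (3-$\mathit{prop}\leftrightarrow$7-$\mathit{prop}$) for all $R$, then for all $R$: 2-$\mathit{prop}\leftrightarrow$6-$\mathit{prop}$,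 4-$\mathit{prop}\leftrightarrow$6-$\mathit{prop}$, 5-$\mathit{prop}\leftrightarrow$7-$\mathit{prop}$, A-$\mathit{prop}\leftrightarrow$E-$\mathit{prop}$, B-$\mathit{prop}\leftrightarrow$F-$\mathit{prop}$, C-$\mathit{prop}\leftrightarrow$E-$\mathit{prop}$, D-$\mathit{prop}\leftrightarrow$F-$\mathit{prop}$. The hypothesis holds for $\mathit{prop}\in\{$reflexive, quasi-reflexive$\}$. (5) If (1-$\mathit{prop}\leftrightarrow$E-$\mathit{prop}$) for all $R$, then for all $R$: 0-$\mathit{prop}\leftrightarrow$F-$\mathit{prop}$, 6-$\mathit{prop}\leftrightarrow$9-$\mathit{prop}$, 7-$\mathit{prop}\leftrightarrow$8-$\mathit{prop}$. The hypothesis holds for $\mathit{prop}\in\{$symmetric, semi-order property 1$\}$.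
   Context: A binary relation $R$ on a set $X$ is a subset of $X\times X$; write $xRy$. Unary operations are indexed by hexadecimal digits $p\in\{0,\dots,F\}$, read as 4-bit numbers $p=8p_8+4p_4+2p_2+p_1$; $xR^py$ iff $(\lnot xRy\land\lnot yRx\land p_8=1)\lor(\lnot xRy\land yRx\land p_4=1)\lor(xRy\land\lnot yRx\land p_2=1)\lor(xRy\land yRx\land p_1=1)$. The composition $p\circ r$ of operations is the (unique) operation with $R^{p\circ r}=(R^r)^p$ for all $R$. Properties (free variables universally quantified): reflexive: $xRx$; left quasi-reflexive: $xRy\to xRx$; quasi-reflexive: $xRy\to xRx\land yRy$; symmetric: $xRy\to yRx$; asymmetric: $xRy\to\lnot yRx$; anti-symmetric: $xRy\land x\neq y\to\lnot yRx$; transitive: $xRy\land yRz\to xRz$; anti-transitive: $xRy\land yRz\to\lnot xRz$; dense: $xRz\to\exists y\,(xRy\land yRz)$; semi-order property 1: $wRx\land\lnot xRy\land\lnot yRx\land yRz\to wRz$; semi-order property 2: $xRy\land yRz\to wRx\lor xRw\lor wRy\lor yRw\lor wRz\lor zRw$. -}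

module Defs where

open import Level using (Level)
open import Data.Bool using (Bool; true; false; not; _∧_; _∨_; if_then_else_; T)
open import Data.Product using (_×_; ∃)
open import Data.Sum using (_⊎_)
open import Relation.Nullary using (¬_)
open import Relation.Binary.PropositionalEquality using (_≡_; _≢_)
open import Function.Bundles using (_⇔_)

-- A binary relation on a set X.  Relations are taken to be Bool-valued
-- (i.e. classical / decidable), so that x R y is  T (R x y).
BRel : Set → Set
BRel X = X → X → Bool

-- The 16 unary operations, indexed by hexadecimal digits 0..F.
data Hex : Set where
  h0 h1 h2 h3 h4 h5 h6 h7 h8 h9 hA hB hC hD hE hF : Hex

fromBits : Bool → Bool → Bool → Bool → Hex
fromBits false false false false = h0
fromBits false false false true  = h1
fromBits false false true  false = h2
fromBits false false true  true  = h3
fromBits false true  false false = h4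
fromBits false true  false true  = h5
fromBits false true  true  false = h6
fromBits false true  true  true  = h7
fromBits true  false false false = h8
fromBits true  false false true  = h9
fromBits true  false true  false = hA
fromBits true  false true  true  = hB
fromBits true  true  false false = hC
fromBits true  true  false true  = hD
fromBits true  true  true  false = hE
fromBits true  true  true  true  = hF

bit8 bit4 bit2 bit1 : Hex → Bool
bit8 h0 = false
bit8 h1 = false
bit8 h2 = false
bit8 h3 = false
bit8 h4 = false
bit8 h5 = false
bit8 h6 = false
bit8 h7 = false
bit8 _  = true
bit4 h4 = true
bit4 h5 = true
bit4 h6 = true
bit4 h7 = true
bit4 hC = true
bit4 hD = true
bit4 hE = true
bit4 hF = true
bit4 _  = false
bit2 h2 = true
bit2 h3 = true
bit2 h6 = true
bit2 h7 = true
bit2 hA = true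
bit2 hB = true
bit2 hE = true
bit2 hF = true
bit2 _  = false
bit1 h1 = true
bit1 h3 = true
bit1 h5 = true
bit1 h7 = true
bit1 h9 = true
bit1 hB = true
bit1 hD = true
bit1 hF = true
bit1 _  = false

_^_ : {X : Set} → BRel X → Hex → BRel X
(R ^ p) x y =
     (not (R x y) ∧ not (R y x) ∧ bit8 p)
  ∨ (not (R x y) ∧ R y x ∧ bit4 p)
  ∨ (R x y ∧ not (R y x) ∧ bit2 p)
  ∨ (R x y ∧ R y x ∧ bit1 p)

-- Value of the operation p on a pair whose (xRy , yRx) status is (a , b).
applyBits : Hex → Bool → Bool → Bool
applyBits p a b = if a then (if b then bit1 p else bit2 p)
                       else (if b then bit4 p else bit8 p)

-- Composition p ∘ r: the operation with R^(p∘r) = (R^r)^p for all R.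
-- Computed explicitly: on a pair of class c (8: neither, 4: only yRx,
-- 2: only xRy, 1: both) the relation R^r has status
-- (bit_c r , bit_{swap c} r) where swap exchanges 4 and 2.
_∘op_ : Hex → Hex → Hex
p ∘op r = fromBits (applyBits p (bit8 r) (bit8 r))
                   (applyBits p (bit4 r) (bit2 r))
                   (applyBits p (bit2 r) (bit4 r))
                   (applyBits p (bit1 r) (bit1 r))

-- A property of binary relations (on arbitrary sets).  Since a relation is
-- a subset of X × X, a property must not distinguish pointwise-equal relations.
record Property : Set₁ where
  field
    holds : {X : Set} → BRel X → Set
    resp  : {X : Set} {R S : BRel X} → (∀ x y → R x y ≡ S x y) → holds R → holds S

open Property public

IffOps : Hex → Hex → ({X : Set} → BRel X → Set) → Set₁
IffOps p q P = ∀ {X : Set} (R : BRel X) → P (R ^ p) ⇔ P (R ^ q)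

IsReflexive : {X : Set} → BRel X → Set
IsReflexive {X} R = ∀ (x : X) → T (R x x)

IsQuasiReflexive : {X : Set} → BRel X → Set
IsQuasiReflexive {X} R = ∀ (x y : X) → T (R x y) → T (R x x) × T (R y y)

IsSymmetric : {X : Set} → BRel X → Set
IsSymmetric {X} R = ∀ (x y : X) → T (R x y) → T (R y x)

IsAsymmetric : {X : Set} → BRel X → Set
IsAsymmetric {X} R = ∀ (x y : X) → T (R x y) → ¬ T (R y x)

IsAntiSymmetric : {X : Set} → BRel X → Set
IsAntiSymmetric {X} R = ∀ (x y : X) → T (R x y) → x ≢ y → ¬ T (R y x)

IsTransitive : {X : Set} → BRel X → Set
IsTransitive {X} R = ∀ (x y z : X) → T (R x y) → T (R y z) → T (R x z)

IsAntiTransitive : {X : Set} → BRel X → Set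
IsAntiTransitive {X} R = ∀ (x y z : X) → T (R x y) → T (R y z) → ¬ T (R x z)

IsDense : {X : Set} → BRel X → Set
IsDense {X} R = ∀ (x z : X) → T (R x z) → ∃ λ (y : X) → T (R x y) × T (R y z)

IsSemiOrder1 : {X : Set} → BRel X → Set
IsSemiOrder1 {X} R = ∀ (w x y z : X) →
  T (R w x) → ¬ T (R x y) → ¬ T (R y x) → T (R y z) → T (R w z)

IsSemiOrder2 : {X : Set} → BRel X → Set
IsSemiOrder2 {X} R = ∀ (w x y z : X) → T (R x y) → T (R y z) →
  T (R w x) ⊎ T (R x w) ⊎ T (R w y) ⊎ T (R y w) ⊎ T (R w z) ⊎ T (R z w)

{-# OPTIONS --safe #-}
module Submission where

open import Defs
open import Data.Bool using (Bool; true; false; not; _∧_; _∨_; T)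
open import Data.Bool.Properties using (∨-identityʳ; not-involutive; T-∧; T-∨)
open import Data.Product using (_×_; _,_; proj₁; proj₂)
open import Data.Sum using (inj₁; inj₂; [_,_]) renaming (map to ⊎-map)
open import Data.Empty using (⊥-elim)
open import Data.Unit using (tt)
open import Function.Base using (_∘_; id; flip)
open import Function.Bundles using (_⇔_; mk⇔; Equivalence)
open import Relation.Nullary using (¬_)
open import Relation.Nullary.Decidable using (T?; decidable-stable)
open import Relation.Binary.PropositionalEquality using (_≡_; refl; sym; trans; cong₂; subst; module ≡-Reasoning)
open Equivalence using (to; from)

-- The value (R ^ p) x y depends only on the pair (R x y , R y x), and R ^ p is
-- pointwise applyBits p applied to it.  Composition of operations is therefore
-- composition of these Boolean maps, R ^ (p ∘op r) = (R ^ r) ^ p, so every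
-- implication P₁ (R ^ p₁) → P₂ (R ^ p₂) valid for all R may be instantiated at
-- R ^ r; the listed equivalences (2)-(5) are such instances, e.g. 3 ∘ 2 = 2 and
-- 5 ∘ 2 = 4.  For the concrete properties one reads off R ^ 3 = R, R ^ 5 = R˘,
-- R ^ 1 = R ∩ R˘, R ^ 7 = R ∪ R˘ and R ^ E = ∁ (R ∩ R˘).

^-applyBits : ∀ {X : Set} (R : BRel X) (p : Hex) (x y : X) →
              (R ^ p) x y ≡ applyBits p (R x y) (R y x)
^-applyBits R p x y with R x y | R y x
... | true  | true  = refl
... | true  | false = ∨-identityʳ (bit2 p)
... | false | true  = ∨-identityʳ (bit4 p)
... | false | false = ∨-identityʳ (bit8 p)

bits-fromBits : ∀ a b c d → bit8 (fromBits a b c d) ≡ a × bit4 (fromBits a b c d) ≡ b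
                          × bit2 (fromBits a b c d) ≡ c × bit1 (fromBits a b c d) ≡ d
bits-fromBits false false false false = refl , refl , refl , refl
bits-fromBits false false false true  = refl , refl , refl , refl
bits-fromBits false false true  false = refl , refl , refl , refl
bits-fromBits false false true  true  = refl , refl , refl , refl
bits-fromBits false true  false false = refl , refl , refl , refl
bits-fromBits false true  false true  = refl , refl , refl , refl
bits-fromBits false true  true  false = refl , refl , refl , refl
bits-fromBits false true  true  true  = refl , refl , refl , refl
bits-fromBits true  false false false = refl , refl , refl , refl
bits-fromBits true  false false true  = refl , refl , refl , refl
bits-fromBits true  false true  false = refl , refl , refl , refl
bits-fromBits true  false true  true  = refl , refl , refl , refl
bits-fromBits true  true  false false = refl , refl , refl , refl
bits-fromBits true  true  false true  = refl , refl , refl , refl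
bits-fromBits true  true  true  false = refl , refl , refl , refl
bits-fromBits true  true  true  true  = refl , refl , refl , refl

applyBits-∘op : ∀ p r a b →
                applyBits (p ∘op r) a b ≡ applyBits p (applyBits r a b) (applyBits r b a)
applyBits-∘op p r false false = proj₁ (bits-fromBits _ _ _ _)
applyBits-∘op p r false true  = proj₁ (proj₂ (bits-fromBits _ _ _ _))
applyBits-∘op p r true  false = proj₁ (proj₂ (proj₂ (bits-fromBits _ _ _ _)))
applyBits-∘op p r true  true  = proj₂ (proj₂ (proj₂ (bits-fromBits _ _ _ _)))

infix 4 _≐_

_≐_ : {X : Set} → BRel X → BRel X → Set
R ≐ S = ∀ x y → R x y ≡ S x y

≐-sym : {X : Set} {R S : BRel X} → R ≐ S → S ≐ R
≐-sym R≐S x y = sym (R≐S x y)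

≐⇒T : {X : Set} {R S : BRel X} → R ≐ S → ∀ {x y} → T (R x y) → T (S x y)
≐⇒T R≐S {x} {y} = subst T (R≐S x y)

^-∘op : ∀ {X : Set} (R : BRel X) (p r : Hex) → R ^ (p ∘op r) ≐ (R ^ r) ^ p
^-∘op R p r x y = begin
  (R ^ (p ∘op r)) x y                                                   ≡⟨ ^-applyBits R (p ∘op r) x y ⟩
  applyBits (p ∘op r) (R x y) (R y x)                                   ≡⟨ applyBits-∘op p r (R x y) (R y x) ⟩
  applyBits p (applyBits r (R x y) (R y x)) (applyBits r (R y x) (R x y)) ≡⟨ sym (cong₂ (applyBits p) (^-applyBits R r x y) (^-applyBits R r y x)) ⟩
  applyBits p ((R ^ r) x y) ((R ^ r) y x)                               ≡⟨ sym (^-applyBits (R ^ r) p x y) ⟩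
  ((R ^ r) ^ p) x y                                                     ∎
  where open ≡-Reasoning

∘op-preserves-implication :
  (P₁ P₂ : Property) (p₁ p₂ : Hex)
  → (∀ {X : Set} (R : BRel X) → holds P₁ (R ^ p₁) → holds P₂ (R ^ p₂))
  → ∀ (r : Hex) {X : Set} (R : BRel X)
  → holds P₁ (R ^ (p₁ ∘op r)) → holds P₂ (R ^ (p₂ ∘op r))
∘op-preserves-implication P₁ P₂ p₁ p₂ imp r R =
  resp P₂ (≐-sym (^-∘op R p₂ r)) ∘ imp (R ^ r) ∘ resp P₁ (^-∘op R p₁ r)

IffOps-∘op : (P : Property) (p q : Hex) → IffOps p q (holds P) →
             (r : Hex) → IffOps (p ∘op r) (q ∘op r) (holds P)
IffOps-∘op P p q p⇔q r R = mk⇔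
  (∘op-preserves-implication P P p q (to ∘ p⇔q) r R)
  (∘op-preserves-implication P P q p (from ∘ p⇔q) r R)

IffOps-via : (P : Property) (p q : Hex) (f g : ∀ {X : Set} → BRel X → BRel X)
  → (∀ {X : Set} (R : BRel X) → R ^ p ≐ f R)
  → (∀ {X : Set} (R : BRel X) → R ^ q ≐ g R)
  → (∀ {X : Set} (R : BRel X) → holds P (f R) ⇔ holds P (g R))
  → IffOps p q (holds P)
IffOps-via P p q f g p≐f q≐g f⇔g R = mk⇔
  (resp P (≐-sym (q≐g R)) ∘ to (f⇔g R) ∘ resp P (p≐f R))
  (resp P (≐-sym (p≐f R)) ∘ from (f⇔g R) ∘ resp P (q≐g R))

symmetricPart symmetricClosure complement : {X : Set} → BRel X → BRel X
symmetricPart R x y = R x y ∧ R y x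
symmetricClosure R x y = R x y ∨ R y x
complement R x y = not (R x y)

^-pointwise : (p : Hex) (f : Bool → Bool → Bool) → (∀ a b → applyBits p a b ≡ f a b) →
              ∀ {X : Set} (R : BRel X) → R ^ p ≐ λ x y → f (R x y) (R y x)
^-pointwise p f applyBits≡f R x y = trans (^-applyBits R p x y) (applyBits≡f (R x y) (R y x))

^-h3 : ∀ {X : Set} (R : BRel X) → R ^ h3 ≐ R
^-h3 = ^-pointwise h3 (λ a _ → a)
  λ { true true → refl ; true false → refl ; false true → refl ; false false → refl }

^-h5 : ∀ {X : Set} (R : BRel X) → R ^ h5 ≐ flip R
^-h5 = ^-pointwise h5 (λ _ b → b)
  λ { true true → refl ; true false → refl ; false true → refl ; false false → refl }

^-h1 : ∀ {X : Set} (R : BRel X) → R ^ h1 ≐ symmetricPart R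
^-h1 = ^-pointwise h1 _∧_
  λ { true true → refl ; true false → refl ; false true → refl ; false false → refl }

^-h7 : ∀ {X : Set} (R : BRel X) → R ^ h7 ≐ symmetricClosure R
^-h7 = ^-pointwise h7 _∨_
  λ { true true → refl ; true false → refl ; false true → refl ; false false → refl }

^-hE : ∀ {X : Set} (R : BRel X) → R ^ hE ≐ complement (symmetricPart R)
^-hE = ^-pointwise hE (λ a b → not (a ∧ b))
  λ { true true → refl ; true false → refl ; false true → refl ; false false → refl }

module _ {X : Set} {R S : BRel X} (R≐S : R ≐ S) where
  private
    ⇒ : ∀ {x y} → T (R x y) → T (S x y)
    ⇒ = ≐⇒T R≐S
    ⇐ : ∀ {x y} → T (S x y) → T (R x y)
    ⇐ = ≐⇒T (≐-sym R≐S)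

  IsReflexive-resp : IsReflexive R → IsReflexive S
  IsReflexive-resp reflR x = ⇒ (reflR x)

  IsQuasiReflexive-resp : IsQuasiReflexive R → IsQuasiReflexive S
  IsQuasiReflexive-resp qrefl x y xSy = let xRx , yRy = qrefl x y (⇐ xSy) in ⇒ xRx , ⇒ yRy

  IsSymmetric-resp : IsSymmetric R → IsSymmetric S
  IsSymmetric-resp symR x y xSy = ⇒ (symR x y (⇐ xSy))

  IsAsymmetric-resp : IsAsymmetric R → IsAsymmetric S
  IsAsymmetric-resp asym x y xSy ySx = asym x y (⇐ xSy) (⇐ ySx)

  IsAntiSymmetric-resp : IsAntiSymmetric R → IsAntiSymmetric S
  IsAntiSymmetric-resp antisym x y xSy x≢y ySx = antisym x y (⇐ xSy) x≢y (⇐ ySx)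

  IsTransitive-resp : IsTransitive R → IsTransitive S
  IsTransitive-resp transR x y z xSy ySz = ⇒ (transR x y z (⇐ xSy) (⇐ ySz))

  IsAntiTransitive-resp : IsAntiTransitive R → IsAntiTransitive S
  IsAntiTransitive-resp atrans x y z xSy ySz xSz = atrans x y z (⇐ xSy) (⇐ ySz) (⇐ xSz)

  IsDense-resp : IsDense R → IsDense S
  IsDense-resp dense x z xSz = let y , xRy , yRz = dense x z (⇐ xSz) in y , ⇒ xRy , ⇒ yRz

  IsSemiOrder1-resp : IsSemiOrder1 R → IsSemiOrder1 S
  IsSemiOrder1-resp so1 w x y z wSx ¬xSy ¬ySx ySz =
    ⇒ (so1 w x y z (⇐ wSx) (¬xSy ∘ ⇒) (¬ySx ∘ ⇒) (⇐ ySz))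

  IsSemiOrder2-resp : IsSemiOrder2 R → IsSemiOrder2 S
  IsSemiOrder2-resp so2 w x y z xSy ySz =
    ⊎-map ⇒ (⊎-map ⇒ (⊎-map ⇒ (⊎-map ⇒ (⊎-map ⇒ ⇒)))) (so2 w x y z (⇐ xSy) (⇐ ySz))

reflexive quasiReflexive symmetric asymmetric antiSymmetric : Property
transitive antiTransitive dense semiOrder1 semiOrder2 : Property
reflexive      = record { holds = IsReflexive      ; resp = IsReflexive-resp }
quasiReflexive = record { holds = IsQuasiReflexive ; resp = IsQuasiReflexive-resp }
symmetric      = record { holds = IsSymmetric      ; resp = IsSymmetric-resp }
asymmetric     = record { holds = IsAsymmetric     ; resp = IsAsymmetric-resp }
antiSymmetric  = record { holds = IsAntiSymmetric  ; resp = IsAntiSymmetric-resp }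
transitive     = record { holds = IsTransitive     ; resp = IsTransitive-resp }
antiTransitive = record { holds = IsAntiTransitive ; resp = IsAntiTransitive-resp }
dense          = record { holds = IsDense          ; resp = IsDense-resp }
semiOrder1     = record { holds = IsSemiOrder1     ; resp = IsSemiOrder1-resp }
semiOrder2     = record { holds = IsSemiOrder2     ; resp = IsSemiOrder2-resp }

ConverseInvariant : Property → Set₁
ConverseInvariant P = ∀ {X : Set} (R : BRel X) → holds P R → holds P (flip R)

IffOps-h3-h5 : (P : Property) → ConverseInvariant P → IffOps h3 h5 (holds P)
IffOps-h3-h5 P inv = IffOps-via P h3 h5 (λ R → R) flip ^-h3 ^-h5 (λ R → mk⇔ (inv R) (inv (flip R)))

reflexive-flip : ConverseInvariant reflexive
reflexive-flip _ reflR = reflR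

quasiReflexive-flip : ConverseInvariant quasiReflexive
quasiReflexive-flip _ qrefl x y yRx = let yRy , xRx = qrefl y x yRx in xRx , yRy

symmetric-flip : ConverseInvariant symmetric
symmetric-flip _ symR x y = symR y x

asymmetric-flip : ConverseInvariant asymmetric
asymmetric-flip _ asym x y = asym y x

antiSymmetric-flip : ConverseInvariant antiSymmetric
antiSymmetric-flip _ antisym x y yRx x≢y = antisym y x yRx (x≢y ∘ sym)

transitive-flip : ConverseInvariant transitive
transitive-flip _ transR x y z yRx zRy = transR z y x zRy yRx

antiTransitive-flip : ConverseInvariant antiTransitive
antiTransitive-flip _ atrans x y z yRx zRy = atrans z y x zRy yRx

dense-flip : ConverseInvariant dense
dense-flip _ dense x z zRx = let y , zRy , yRx = dense z x zRx in y , yRx , zRy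

semiOrder1-flip : ConverseInvariant semiOrder1
semiOrder1-flip _ so1 w x y z xRw ¬yRx ¬xRy zRy = so1 z y x w zRy ¬yRx ¬xRy xRw

semiOrder2-flip : ConverseInvariant semiOrder2
semiOrder2-flip _ so2 w x y z yRx zRy with so2 w z y x zRy yRx
... | inj₁ wRz                               = inj₂ (inj₂ (inj₂ (inj₂ (inj₂ wRz))))
... | inj₂ (inj₁ zRw)                        = inj₂ (inj₂ (inj₂ (inj₂ (inj₁ zRw))))
... | inj₂ (inj₂ (inj₁ wRy))                 = inj₂ (inj₂ (inj₂ (inj₁ wRy)))
... | inj₂ (inj₂ (inj₂ (inj₁ yRw)))          = inj₂ (inj₂ (inj₁ yRw))
... | inj₂ (inj₂ (inj₂ (inj₂ (inj₁ wRx))))   = inj₂ (inj₁ wRx)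
... | inj₂ (inj₂ (inj₂ (inj₂ (inj₂ xRw))))   = inj₁ xRw

T-not : ∀ {b} → T (not b) ⇔ (¬ T b)
T-not {true}  = mk⇔ (λ ()) (λ ¬t → ⊥-elim (¬t tt))
T-not {false} = mk⇔ (λ _ ()) (λ _ → tt)

T-∨-diag : ∀ {b} → T (b ∨ b) → T b
T-∨-diag {b} = [ id , id ] ∘ to (T-∨ {b} {b})

module _ {X : Set} (R : BRel X) where

  reflexive-symmetricPart : IsReflexive (symmetricPart R) ⇔ IsReflexive R
  reflexive-symmetricPart = mk⇔
    (λ reflS x → proj₁ (to T-∧ (reflS x)))
    (λ reflR x → from T-∧ (reflR x , reflR x))

  asymmetric-symmetricPart : IsAsymmetric (symmetricPart R) ⇔ IsAsymmetric R
  asymmetric-symmetricPart = mk⇔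
    (λ asymS x y xRy yRx → asymS x y (from T-∧ (xRy , yRx)) (from T-∧ (yRx , xRy)))
    (λ asymR x y xSy _ → let xRy , yRx = to T-∧ xSy in asymR x y xRy yRx)

  antiSymmetric-symmetricPart : IsAntiSymmetric (symmetricPart R) ⇔ IsAntiSymmetric R
  antiSymmetric-symmetricPart = mk⇔
    (λ antiS x y xRy x≢y yRx → antiS x y (from T-∧ (xRy , yRx)) x≢y (from T-∧ (yRx , xRy)))
    (λ antiR x y xSy x≢y _ → let xRy , yRx = to T-∧ xSy in antiR x y xRy x≢y yRx)

  reflexive-symmetricClosure : IsReflexive R ⇔ IsReflexive (symmetricClosure R)
  reflexive-symmetricClosure = mk⇔
    (λ reflR x → from T-∨ (inj₁ (reflR x)))
    (λ reflC x → T-∨-diag (reflC x))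

  quasiReflexive-symmetricClosure : IsQuasiReflexive R ⇔ IsQuasiReflexive (symmetricClosure R)
  quasiReflexive-symmetricClosure = mk⇔ closure-qrefl qrefl-from-closure
    where
    inl : ∀ {b c} → T b → T (b ∨ c)
    inl = from T-∨ ∘ inj₁

    closure-qrefl : IsQuasiReflexive R → IsQuasiReflexive (symmetricClosure R)
    closure-qrefl qrefl x y xCy with to (T-∨ {R x y}) xCy
    ... | inj₁ xRy                               = let xRx , yRy = qrefl x y xRy in inl xRx , inl yRy
    ... | inj₂ yRx                               = let yRy , xRx = qrefl y x yRx in inl xRx , inl yRy

    qrefl-from-closure : IsQuasiReflexive (symmetricClosure R) → IsQuasiReflexive R
    qrefl-from-closure qrefl x y xRy =
      let xCx , yCy = qrefl x y (inl xRy) in T-∨-diag xCx , T-∨-diag yCy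

  symmetricPart-symmetric : IsSymmetric (symmetricPart R)
  symmetricPart-symmetric x y xSy = let xRy , yRx = to (T-∧ {R x y}) xSy in from (T-∧ {R y x}) (yRx , xRy)

complement-symmetric : {X : Set} {S : BRel X} → IsSymmetric S → IsSymmetric (complement S)
complement-symmetric symS x y x∁y = from T-not (to T-not x∁y ∘ symS y x)

semiOrder1-complement : {X : Set} {S : BRel X} →
                        IsSymmetric S → IsSemiOrder1 S → IsSemiOrder1 (complement S)
semiOrder1-complement {S = S} symS so1 w x y z w∁x _ ¬y∁x y∁z = from T-not λ wSz →
    to T-not y∁z (so1 y x w z ySx (to T-not w∁x ∘ symS x w) (to T-not w∁x) wSz)
  where
  ySx : T (S y x)
  ySx = decidable-stable (T? (S y x)) (¬y∁x ∘ from T-not)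

semiOrder1-complement-⇔ : {X : Set} {S : BRel X} →
                          IsSymmetric S → IsSemiOrder1 S ⇔ IsSemiOrder1 (complement S)
semiOrder1-complement-⇔ {S = S} symS = mk⇔
  (semiOrder1-complement symS)
  (IsSemiOrder1-resp (λ x y → not-involutive (S x y)) ∘ semiOrder1-complement (complement-symmetric symS))

IffOps-h1-h3 : (P : Property) → (∀ {X : Set} (R : BRel X) → holds P (symmetricPart R) ⇔ holds P R) →
               IffOps h1 h3 (holds P)
IffOps-h1-h3 P = IffOps-via P h1 h3 symmetricPart (λ R → R) ^-h1 ^-h3

IffOps-h3-h7 : (P : Property) → (∀ {X : Set} (R : BRel X) → holds P R ⇔ holds P (symmetricClosure R)) →
               IffOps h3 h7 (holds P)
IffOps-h3-h7 P = IffOps-via P h3 h7 (λ R → R) symmetricClosure ^-h3 ^-h7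

IffOps-h1-hE : (P : Property) →
               (∀ {X : Set} {S : BRel X} → IsSymmetric S → holds P S ⇔ holds P (complement S)) →
               IffOps h1 hE (holds P)
IffOps-h1-hE P P-complement = IffOps-via P h1 hE symmetricPart (complement ∘ symmetricPart) ^-h1 ^-hE
  (λ R → P-complement (symmetricPart-symmetric R))

symmetric-complement-⇔ : {X : Set} {S : BRel X} → IsSymmetric S → IsSymmetric S ⇔ IsSymmetric (complement S)
symmetric-complement-⇔ symS = mk⇔ (λ _ → complement-symmetric symS) (λ _ → symS)

mainTheorem12 :
      -- (1)
      ( (P₁ P₂ : Property) (p₁ p₂ : Hex)
        → (∀ {X : Set} (R : BRel X) → holds P₁ (R ^ p₁) → holds P₂ (R ^ p₂))
        → ∀ (r : Hex) {X : Set} (R : BRel X)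
        → holds P₁ (R ^ (p₁ ∘op r)) → holds P₂ (R ^ (p₂ ∘op r)) )
      -- (2)
    × ( (P : Property) → IffOps h3 h5 (holds P)
        → IffOps h2 h4 (holds P) × IffOps hA hC (holds P) × IffOps hB hD (holds P) )
    × ( IffOps h3 h5 IsReflexive × IffOps h3 h5 IsQuasiReflexive
        × IffOps h3 h5 IsSymmetric × IffOps h3 h5 IsAsymmetric
        × IffOps h3 h5 IsAntiSymmetric × IffOps h3 h5 IsTransitive
        × IffOps h3 h5 IsAntiTransitive × IffOps h3 h5 IsSemiOrder1
        × IffOps h3 h5 IsSemiOrder2 × IffOps h3 h5 IsDense )
      -- (3)
    × ( (P : Property) → IffOps h1 h3 (holds P)
        → IffOps h0 h4 (holds P) × IffOps h1 h5 (holds P) × IffOps h8 hA (holds P)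
          × IffOps h9 hB (holds P) × IffOps h8 hC (holds P) )
    × ( IffOps h1 h3 IsReflexive × IffOps h1 h3 IsAsymmetric
        × IffOps h1 h3 IsAntiSymmetric )
      -- (4)
    × ( (P : Property) → IffOps h3 h7 (holds P)
        → IffOps h2 h6 (holds P) × IffOps h4 h6 (holds P) × IffOps h5 h7 (holds P)
          × IffOps hA hE (holds P) × IffOps hB hF (holds P) × IffOps hC hE (holds P)
          × IffOps hD hF (holds P) )
    × ( IffOps h3 h7 IsReflexive × IffOps h3 h7 IsQuasiReflexive )
      -- (5)
    × ( (P : Property) → IffOps h1 hE (holds P)
        → IffOps h0 hF (holds P) × IffOps h6 h9 (holds P) × IffOps h7 h8 (holds P) )
    × ( IffOps h1 hE IsSymmetric × IffOps h1 hE IsSemiOrder1 )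
mainTheorem12 =
    ∘op-preserves-implication
  , (λ P 3⇔5 → let _∘r = IffOps-∘op P h3 h5 3⇔5 in h2 ∘r , hA ∘r , hB ∘r)
  , ( IffOps-h3-h5 reflexive reflexive-flip , IffOps-h3-h5 quasiReflexive quasiReflexive-flip
    , IffOps-h3-h5 symmetric symmetric-flip , IffOps-h3-h5 asymmetric asymmetric-flip
    , IffOps-h3-h5 antiSymmetric antiSymmetric-flip , IffOps-h3-h5 transitive transitive-flip
    , IffOps-h3-h5 antiTransitive antiTransitive-flip , IffOps-h3-h5 semiOrder1 semiOrder1-flip
    , IffOps-h3-h5 semiOrder2 semiOrder2-flip , IffOps-h3-h5 dense dense-flip )
  , (λ P 1⇔3 → let _∘r = IffOps-∘op P h1 h3 1⇔3 in h4 ∘r , h5 ∘r , hA ∘r , hB ∘r , hC ∘r)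
  , ( IffOps-h1-h3 reflexive reflexive-symmetricPart
    , IffOps-h1-h3 asymmetric asymmetric-symmetricPart
    , IffOps-h1-h3 antiSymmetric antiSymmetric-symmetricPart )
  , (λ P 3⇔7 → let _∘r = IffOps-∘op P h3 h7 3⇔7 in
               h2 ∘r , h4 ∘r , h5 ∘r , hA ∘r , hB ∘r , hC ∘r , hD ∘r)
  , ( IffOps-h3-h7 reflexive reflexive-symmetricClosure
    , IffOps-h3-h7 quasiReflexive quasiReflexive-symmetricClosure )
  , (λ P 1⇔E → let _∘r = IffOps-∘op P h1 hE 1⇔E in h0 ∘r , h6 ∘r , h7 ∘r)
  , ( IffOps-h1-hE symmetric symmetric-complement-⇔
    , IffOps-h1-hE semiOrder1 semiOrder1-complement-⇔ )
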